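{- For every constant $\epsilon>0$, every comparison-based $n^{1-\epsilon}$-approximation algorithm for the one-dimensional Traveling Salesman (path) Problem requires $\Omega(\epsilon\, n\log n)$ comparisons in the worst case on inputs of size $n$. That is, there is an absolute constant $c>0$ such that for every constant $\epsilon>0$ and all sufficiently large $n$, any such algorithm uses at least $c\,\epsilon\, n\log n$ comparisons on some input of $n$ points.
   Context: One-dimensional TSP (path version): the input is $n$ real numbers $x_1,\dots,x_n$; a solution is an ordering of them, i.e. a permutation $\sigma$ of $\{1,\dots,n\}$, with cost $\sum_{i=1}^{n-1}|x_{\sigma(i+1)}-x_{\sigma(i)}|$. An $r$-approximation algorithm always outputs a solution whose cost is at most $r$ times the minimum possible cost. A comparison-based algorithm is one that accesses the input only through binary (True/False) queries; the number of comparisons is the number of such queries made.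
   Formalization: The input numbers $x_1,\dots,x_n$ are rationals rather than reals, and the constant ε ranges over the positive rationals. -}

module Defs where

open import Data.Bool using (Bool; true; false)
open import Data.Nat using (ℕ; zero; suc)
open import Data.Integer using (+_)
open import Data.Rational using (ℚ; _+_; _-_; _*_; ∣_∣; _≤_; _/_; 1ℚ; 0ℚ)
open import Data.List using (List; []; _∷_; map)
open import Data.Fin using (Fin)
open import Data.Fin.Permutation using (Permutation′; _⟨$⟩ʳ_)
open import Data.Vec using (Vec; lookup; toList; tabulate)

Input : ℕ → Set
Input n = Vec ℚ n

pathCost : List ℚ → ℚ
pathCost []           = 0ℚ
pathCost (x ∷ [])     = 0ℚ
pathCost (x ∷ y ∷ ys) = ∣ y - x ∣ + pathCost (y ∷ ys)

tourCost : ∀ {n} → Input n → Permutation′ n → ℚ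
tourCost {n} xs σ = pathCost (toList (tabulate (λ i → lookup xs (σ ⟨$⟩ʳ i))))

-- A comparison-based algorithm on inputs of size n: a binary decision tree
-- whose internal nodes are arbitrary binary (True/False) queries on the input
-- and whose leaves output an ordering (permutation).
data Tree (n : ℕ) : Set where
  leaf  : Permutation′ n → Tree n
  query : (Input n → Bool) → Tree n → Tree n → Tree n

run : ∀ {n} → Tree n → Input n → Permutation′ n
run (leaf σ)      xs = σ
run (query f t e) xs with f xs
... | true  = run t xs
... | false = run e xs

comparisons : ∀ {n} → Tree n → Input n → ℕ
comparisons (leaf σ)      xs = 0
comparisons (query f t e) xs with f xs
... | true  = suc (comparisons t xs)
... | false = suc (comparisons e xs)

_^ℚ_ : ℚ → ℕ → ℚ
x ^ℚ zero  = 1ℚ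
x ^ℚ suc k = x * (x ^ℚ k)

ℕ→ℚ : ℕ → ℚ
ℕ→ℚ m = (+ m) / 1

-- T is an n^(1-p/q)-approximation algorithm (q > 0):
-- for every input xs and every ordering τ,
--   cost(run T xs) ≤ n^(1 - p/q) · cost(τ),
-- written without real powers (both sides are ≥ 0, raise to the q-th power
-- and multiply by n^p):  cost(run T xs)^q · n^p ≤ n^q · cost(τ)^q.
IsApprox : (n p q : ℕ) → Tree n → Set
IsApprox n p q T =
  ∀ (xs : Input n) (τ : Permutation′ n) →
    (tourCost xs (run T xs) ^ℚ q) * (ℕ→ℚ n ^ℚ p) ≤ (ℕ→ℚ n ^ℚ q) * (tourCost xs τ ^ℚ q)

-- Run the algorithm on the n! inputs that place the points 0, 1, …, n − 1 in every possible order.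
-- On each of them the optimal tour costs n − 1, so the tour it outputs costs at most about n^(2 − ε).
-- Such a tour can be written down cheaply: its first point, then for every step either the offset of
-- a short move (at most D ≈ n^(1 − ε/2)) or a marker, the targets of the at most cost/D ≤ D long moves
-- being listed separately. Together with the K answers the algorithm received, which determine its
-- output, this recovers the input, so n! ≤ 2^K · n · (2D + 2)^n · n^D; comparing logarithms gives
-- K ≥ (ε/8) n log₂ n for n large enough in terms of q.
module Submission where

open import Defs
open import Data.Nat using (ℕ; _+_; _*_; _^_; _≤_; _<_)
open import Data.Product using (Σ; ∃; _×_)

open import Data.Bool using (Bool; true; false)
open import Data.Empty using (⊥; ⊥-elim)
open import Data.Fin as Fin using (Fin; toℕ; fromℕ<; combine; remQuot; punchIn; funToFin; finToFun)
open import Data.Fin.Properties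
  using (toℕ-injective; toℕ-fromℕ<; punchIn-injective; combine-remQuot; combine-injective; finToFun-funToFin; 2↔Bool; any?; injective⇒≤)
  renaming (0≢1+n to zero≢suc)
open import Data.Fin.Permutation using (Permutation′; _⟨$⟩ʳ_; _⟨$⟩ˡ_; flip; inverseʳ; insert; insert-punchIn) renaming (id to idPerm)
open import Data.Integer as ℤ using (+_)
import Data.Integer.Properties as ℤ
open import Data.List as List using (List; []; _∷_; _++_)
open import Data.Maybe using (Maybe; just; nothing)
open import Data.Nat using (zero; suc; _∸_; ∣_-_∣; _!; _/_; _%_; _≤?_; NonZero; z≤n; s≤s; z<s; >-nonZero)
open import Data.Nat.Coprimality using (1-coprimeTo) renaming (sym to coprime-sym)
open import Data.Nat.DivMod using (m≡m%n+[m/n]*n; m%n≤n; m/n*n≤m)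
open import Data.Nat.Properties
open import Data.Nat.Tactic.RingSolver using (solve-∀)
open import Data.Product using (_,_; proj₁; proj₂)
open import Data.Rational as ℚ using (ℚ; mkℚ)
import Data.Rational.Properties as ℚ
import Data.Rational.Unnormalised as ℚᵘ
import Data.Rational.Unnormalised.Properties as ℚᵘ
open import Data.Sum using (inj₁; inj₂)
open import Data.Vec as Vec using (Vec; []; _∷_; lookup; tabulate; toList; fromList; padRight)
open import Data.Vec.Properties
  using (lookup∘tabulate; lookup-map; tabulate∘lookup; tabulate-cong; tabulate-∘; toList-map; toList∘fromList; toList-replicate)
open import Function using (_∘_; _↣_; mk↣; Injection; Injective)
open import Function.Construct.Identity using (↣-id)
open import Function.Properties.Inverse using (↔⇒↣; ↔-sym)
open import Relation.Nullary using (yes; no; ¬_)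
open import Relation.Unary using (Decidable)
open import Relation.Binary.PropositionalEquality
open import Algebra.Properties.AbelianGroup ℚ.+-0-abelianGroup using (xyx⁻¹≈y; ⁻¹-anti-homo‿-)

-- Natural numbers inside ℚ

-- ℕ→ℚ normalises through a gcd computation; ι is the same embedding written in normal form,
-- on which the field operations compute.
ι : ℕ → ℚ
ι m = mkℚ (+ m) 0 (coprime-sym (1-coprimeTo m))

ℕ→ℚ≡ι : ∀ m → ℕ→ℚ m ≡ ι m
ℕ→ℚ≡ι m = ℚ.normalize-coprime (coprime-sym (1-coprimeTo m))

ι-homo-+ : ∀ a b → ι (a + b) ≡ ι a ℚ.+ ι b
ι-homo-+ a b = ℚ.toℚᵘ-injective
  (ℚᵘ.≃-sym (ℚᵘ.≃-trans (ℚ.toℚᵘ-homo-+ (ι a) (ι b)) (ℚᵘ.*≡* (cong (ℤ._* + 1) numerators))))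
  where
  numerators : + a ℤ.* + 1 ℤ.+ + b ℤ.* + 1 ≡ + (a + b)
  numerators = trans (cong₂ ℤ._+_ (ℤ.*-identityʳ (+ a)) (ℤ.*-identityʳ (+ b))) (sym (ℤ.pos-+ a b))

ι-homo-* : ∀ a b → ι (a * b) ≡ ι a ℚ.* ι b
ι-homo-* a b = ℚ.toℚᵘ-injective
  (ℚᵘ.≃-sym (ℚᵘ.≃-trans (ℚ.toℚᵘ-homo-* (ι a) (ι b)) (ℚᵘ.*≡* (cong (ℤ._* + 1) (sym (ℤ.pos-* a b))))))

ι-homo-^ : ∀ a k → ι (a ^ k) ≡ ι a ^ℚ k
ι-homo-^ a zero    = refl
ι-homo-^ a (suc k) = trans (ι-homo-* a (a ^ k)) (cong (ι a ℚ.*_) (ι-homo-^ a k))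

ι-monomial : ∀ a b k l → ι a ^ℚ k ℚ.* ι b ^ℚ l ≡ ι (a ^ k * b ^ l)
ι-monomial a b k l = sym (trans (ι-homo-* (a ^ k) (b ^ l)) (cong₂ ℚ._*_ (ι-homo-^ a k) (ι-homo-^ b l)))

ι-cancel-≤ : ∀ {a b} → ι a ℚ.≤ ι b → a ≤ b
ι-cancel-≤ {a} {b} (ℚ.*≤* a≤b) = ℤ.drop‿+≤+ (subst₂ ℤ._≤_ (ℤ.*-identityʳ (+ a)) (ℤ.*-identityʳ (+ b)) a≤b)

ι-∸ : ∀ {a b} → a ≤ b → ι b ℚ.- ι a ≡ ι (b ∸ a)
ι-∸ {a} {b} a≤b = begin
  ι b ℚ.- ι a                ≡⟨ cong (λ m → ι m ℚ.- ι a) (m+[n∸m]≡n a≤b) ⟨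
  ι (a + (b ∸ a)) ℚ.- ι a    ≡⟨ cong (ℚ._- ι a) (ι-homo-+ a (b ∸ a)) ⟩
  ι a ℚ.+ ι (b ∸ a) ℚ.- ι a  ≡⟨ xyx⁻¹≈y (ι a) (ι (b ∸ a)) ⟩
  ι (b ∸ a)                  ∎
  where open ≡-Reasoning

ι-distance : ∀ a b → ℚ.∣ ι b ℚ.- ι a ∣ ≡ ι ∣ b - a ∣
ι-distance a b with ≤-total a b
... | inj₁ a≤b = begin
  ℚ.∣ ι b ℚ.- ι a ∣  ≡⟨ cong ℚ.∣_∣ (ι-∸ a≤b) ⟩
  ι (b ∸ a)          ≡⟨ cong ι (m≤n⇒∣n-m∣≡n∸m a≤b) ⟨
  ι ∣ b - a ∣        ∎
  where open ≡-Reasoning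
... | inj₂ b≤a = begin
  ℚ.∣ ι b ℚ.- ι a ∣            ≡⟨ cong ℚ.∣_∣ (⁻¹-anti-homo‿- (ι a) (ι b)) ⟨
  ℚ.∣ ℚ.- (ι a ℚ.- ι b) ∣      ≡⟨ ℚ.∣-p∣≡∣p∣ (ι a ℚ.- ι b) ⟩
  ℚ.∣ ι a ℚ.- ι b ∣            ≡⟨ cong ℚ.∣_∣ (ι-∸ b≤a) ⟩
  ι (a ∸ b)                    ≡⟨ cong ι (m≤n⇒∣m-n∣≡n∸m b≤a) ⟨
  ι ∣ b - a ∣                  ∎
  where open ≡-Reasoning

pathCostℕ : List ℕ → ℕ
pathCostℕ []           = 0
pathCostℕ (x ∷ [])     = 0
pathCostℕ (x ∷ y ∷ ys) = ∣ y - x ∣ + pathCostℕ (y ∷ ys)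

pathCost-map-ι : ∀ ys → pathCost (List.map ι ys) ≡ ι (pathCostℕ ys)
pathCost-map-ι []           = refl
pathCost-map-ι (x ∷ [])     = refl
pathCost-map-ι (x ∷ y ∷ ys) = trans (cong₂ ℚ._+_ (ι-distance x y) (pathCost-map-ι (y ∷ ys))) (sym (ι-homo-+ ∣ y - x ∣ _))

tourCost-tabulate-ι : ∀ {n} (y : Fin n → ℕ) (σ : Permutation′ n) →
  tourCost (tabulate (ι ∘ y)) σ ≡ ι (pathCostℕ (toList (tabulate (y ∘ (σ ⟨$⟩ʳ_)))))
tourCost-tabulate-ι {n} y σ = begin
  pathCost (toList (tabulate (λ u → lookup (tabulate (ι ∘ y)) (σ ⟨$⟩ʳ u))))
    ≡⟨ cong (pathCost ∘ toList) (tabulate-cong {n = n} (λ u → lookup∘tabulate (ι ∘ y) (σ ⟨$⟩ʳ u))) ⟩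
  pathCost (toList (tabulate (ι ∘ y ∘ (σ ⟨$⟩ʳ_))))
    ≡⟨ cong (pathCost ∘ toList) (tabulate-∘ ι (y ∘ (σ ⟨$⟩ʳ_))) ⟩
  pathCost (toList (Vec.map ι (tabulate (y ∘ (σ ⟨$⟩ʳ_)))))
    ≡⟨ cong pathCost (toList-map ι (tabulate (y ∘ (σ ⟨$⟩ʳ_)))) ⟩
  pathCost (List.map ι (toList (tabulate (y ∘ (σ ⟨$⟩ʳ_)))))
    ≡⟨ pathCost-map-ι (toList (tabulate (y ∘ (σ ⟨$⟩ʳ_)))) ⟩
  ι (pathCostℕ (toList (tabulate (y ∘ (σ ⟨$⟩ʳ_))))) ∎
  where open ≡-Reasoning

pathCostℕ-consecutive : ∀ m a → pathCostℕ (toList (tabulate {suc m} (λ u → a + toℕ u))) ≡ m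
pathCostℕ-consecutive zero    a = refl
pathCostℕ-consecutive (suc m) a = cong₂ _+_ (∣m+n-m+o∣≡∣n-o∣ a 1 0) (begin
  pathCostℕ (toList (tabulate {suc m} (λ u → a + suc (toℕ u))))
    ≡⟨ cong (pathCostℕ ∘ toList) (tabulate-cong {n = suc m} (λ u → +-suc a (toℕ u))) ⟩
  pathCostℕ (toList (tabulate {suc m} (λ u → suc a + toℕ u)))
    ≡⟨ pathCostℕ-consecutive m (suc a) ⟩
  m ∎)
  where open ≡-Reasoning

tourCost-sorting : ∀ {n} (π : Permutation′ (suc n)) → tourCost (tabulate (ι ∘ toℕ ∘ (π ⟨$⟩ʳ_))) (flip π) ≡ ι n
tourCost-sorting {n} π = begin
  tourCost (tabulate (ι ∘ toℕ ∘ (π ⟨$⟩ʳ_))) (flip π)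
    ≡⟨ tourCost-tabulate-ι (toℕ ∘ (π ⟨$⟩ʳ_)) (flip π) ⟩
  ι (pathCostℕ (toList (tabulate (λ u → toℕ (π ⟨$⟩ʳ (π ⟨$⟩ˡ u))))))
    ≡⟨ cong (ι ∘ pathCostℕ ∘ toList) (tabulate-cong {n = suc n} (λ u → cong toℕ (inverseʳ π {u}))) ⟩
  ι (pathCostℕ (toList (tabulate {suc n} (λ u → 0 + toℕ u))))
    ≡⟨ cong ι (pathCostℕ-consecutive n 0) ⟩
  ι n ∎
  where open ≡-Reasoning

injective-pathCost : ∀ {n m} (f : Fin n → Fin m) → 2 ≤ n → Injective _≡_ _≡_ f →
  1 ≤ pathCostℕ (toList (Vec.map toℕ (tabulate f)))
injective-pathCost {suc zero}    f (s≤s ()) _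
injective-pathCost {suc (suc _)} f _ injective = ≤-trans (n≢0⇒n>0 distinct) (m≤m+n _ _)
  where
  distinct : ∣ toℕ (f (Fin.suc Fin.zero)) - toℕ (f Fin.zero) ∣ ≢ 0
  distinct d≡0 = zero≢suc (injective (toℕ-injective (sym (∣m-n∣≡0⇒m≡n d≡0))))

-- Enumerating permutations and replaying decision trees

permutation : ∀ n → Fin (n !) → Permutation′ n
permutation zero    _ = idPerm
permutation (suc n) i = insert Fin.zero (proj₁ (remQuot {suc n} (n !) i)) (permutation n (proj₂ (remQuot {suc n} (n !) i)))

permutation-injective : ∀ n {i j : Fin (n !)} → (∀ t → permutation n i ⟨$⟩ʳ t ≡ permutation n j ⟨$⟩ʳ t) → i ≡ j
permutation-injective zero    {Fin.zero} {Fin.zero} _ = refl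
permutation-injective (suc n) {i} {j} same = begin
  i                      ≡⟨ combine-remQuot {suc n} (n !) i ⟨
  combine image₁ rest₁   ≡⟨ cong₂ combine same-image same-rest ⟩
  combine image₂ rest₂   ≡⟨ combine-remQuot {suc n} (n !) j ⟩
  j                      ∎
  where
  open ≡-Reasoning
  image₁ : Fin (suc n)
  image₁ = proj₁ (remQuot {suc n} (n !) i)
  rest₁ : Fin (n !)
  rest₁ = proj₂ (remQuot {suc n} (n !) i)
  image₂ : Fin (suc n)
  image₂ = proj₁ (remQuot {suc n} (n !) j)
  rest₂ : Fin (n !)
  rest₂ = proj₂ (remQuot {suc n} (n !) j)
  same-image : image₁ ≡ image₂
  same-image = same Fin.zero
  same-rest : rest₁ ≡ rest₂
  same-rest = permutation-injective n λ t → punchIn-injective image₁ _ _ (begin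
    punchIn image₁ (permutation n rest₁ ⟨$⟩ʳ t)        ≡⟨ insert-punchIn Fin.zero image₁ (permutation n rest₁) t ⟨
    permutation (suc n) i ⟨$⟩ʳ Fin.suc t               ≡⟨ same (Fin.suc t) ⟩
    permutation (suc n) j ⟨$⟩ʳ Fin.suc t               ≡⟨ insert-punchIn Fin.zero image₂ (permutation n rest₂) t ⟩
    punchIn image₂ (permutation n rest₂ ⟨$⟩ʳ t)        ≡⟨ cong (λ c → punchIn c (permutation n rest₂ ⟨$⟩ʳ t)) same-image ⟨
    punchIn image₁ (permutation n rest₂ ⟨$⟩ʳ t)        ∎)

transcript : ∀ {n} → Tree n → Input n → (K : ℕ) → Vec Bool K
transcript (leaf σ)      xs K       = Vec.replicate K false
transcript (query f t e) xs zero    = []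
transcript (query f t e) xs (suc K) with f xs
... | true  = true  ∷ transcript t xs K
... | false = false ∷ transcript e xs K

replay : ∀ {n K} → Tree n → Vec Bool K → Permutation′ n
replay (leaf σ)      bs           = σ
replay (query f t e) []           = idPerm
replay (query f t e) (true  ∷ bs) = replay t bs
replay (query f t e) (false ∷ bs) = replay e bs

replay-transcript : ∀ {n} (T : Tree n) xs {K} → comparisons T xs ≤ K → replay T (transcript T xs K) ≡ run T xs
replay-transcript (leaf σ)      xs         _ = refl
replay-transcript (query f t e) xs {zero}  c≤K with f xs
replay-transcript (query f t e) xs {zero}  () | true
replay-transcript (query f t e) xs {zero}  () | false
replay-transcript (query f t e) xs {suc K} c≤K with f xs
... | true  = replay-transcript t xs (≤-pred c≤K)
... | false = replay-transcript e xs (≤-pred c≤K)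

-- Describing a tour by its short steps and its long jumps

module DifferenceCoding (D : ℕ) where

  -- A step to a point within distance D is recorded by its offset b + D ∸ a ∈ [0, 2D];
  -- a longer step is recorded as nothing, and its target is listed separately among the jumps.
  Step : Set
  Step = Maybe (Fin (suc (D + D)))

  offset : ∀ a b → ∣ b - a ∣ ≤ D → Fin (suc (D + D))
  offset a b near = fromℕ< (s≤s (begin
    b + D ∸ a          ≤⟨ ∸-monoˡ-≤ a (+-monoˡ-≤ D (≤-trans (m≤n+∣m-n∣ b a) (+-monoʳ-≤ a near))) ⟩
    a + D + D ∸ a      ≡⟨ cong (_∸ a) (+-assoc a D D) ⟩
    a + (D + D) ∸ a    ≡⟨ m+n∸m≡n a (D + D) ⟩
    D + D              ∎))
    where open ≤-Reasoning

  target : ℕ → Fin (suc (D + D)) → ℕ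
  target a o = a + toℕ o ∸ D

  target-offset : ∀ a b (near : ∣ b - a ∣ ≤ D) → target a (offset a b near) ≡ b
  target-offset a b near = begin
    a + toℕ (offset a b near) ∸ D  ≡⟨ cong (λ o → a + o ∸ D) (toℕ-fromℕ< _) ⟩
    a + (b + D ∸ a) ∸ D            ≡⟨ cong (_∸ D) (m+[n∸m]≡n a≤b+D) ⟩
    b + D ∸ D                      ≡⟨ m+n∸n≡m b D ⟩
    b                              ∎
    where
    open ≡-Reasoning
    a≤b+D : a ≤ b + D
    a≤b+D = ≤-trans (m≤n+∣n-m∣ a b) (+-monoʳ-≤ b near)

  steps : ∀ {n m} → ℕ → Vec (Fin n) m → Vec Step m
  steps a []       = []
  steps a (b ∷ ys) with ∣ toℕ b - a ∣ ≤? D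
  ... | yes near = just (offset a (toℕ b) near) ∷ steps (toℕ b) ys
  ... | no  _    = nothing ∷ steps (toℕ b) ys

  jumps : ∀ {n m} → ℕ → Vec (Fin n) m → List (Fin n)
  jumps a []       = []
  jumps a (b ∷ ys) with ∣ toℕ b - a ∣ ≤? D
  ... | yes _ = jumps (toℕ b) ys
  ... | no  _ = b ∷ jumps (toℕ b) ys

  follow : ∀ {n m} → ℕ → Vec Step m → List (Fin n) → Vec ℕ m
  follow     a []             js       = []
  follow     a (just o ∷ ss)  js       = target a o ∷ follow (target a o) ss js
  follow {n} a (nothing ∷ ss) []       = 0 ∷ follow {n} 0 ss []
  follow     a (nothing ∷ ss) (j ∷ js) = toℕ j ∷ follow (toℕ j) ss js

  follow-steps : ∀ {n m} a (ys : Vec (Fin n) m) extra → follow a (steps a ys) (jumps a ys ++ extra) ≡ Vec.map toℕ ys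
  follow-steps a []       extra = refl
  follow-steps a (b ∷ ys) extra with ∣ toℕ b - a ∣ ≤? D
  ... | yes near = trans (cong (λ c → c ∷ follow c (steps (toℕ b) ys) (jumps (toℕ b) ys ++ extra)) (target-offset a (toℕ b) near))
                       (cong (toℕ b ∷_) (follow-steps (toℕ b) ys extra))
  ... | no  _    = cong (toℕ b ∷_) (follow-steps (toℕ b) ys extra)

  jumps-cost : ∀ {n m} a (ys : Vec (Fin n) m) →
    List.length (jumps a ys) * suc D ≤ pathCostℕ (a ∷ toList (Vec.map toℕ ys))
  jumps-cost a []       = z≤n
  jumps-cost a (b ∷ ys) with ∣ toℕ b - a ∣ ≤? D
  ... | yes _   = ≤-trans (jumps-cost (toℕ b) ys) (m≤n+m _ _)
  ... | no  far = +-mono-≤ (≰⇒> far) (jumps-cost (toℕ b) ys)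

-- Finite codes

toList-padRight : ∀ {A : Set} {m k} (m≤k : m ≤ k) (a : A) (v : Vec A m) →
  toList (padRight m≤k a v) ≡ toList v ++ List.replicate (k ∸ m) a
toList-padRight {k = k} z≤n       a []      = toList-replicate k a
toList-padRight         (s≤s m≤k) a (x ∷ v) = cong (x ∷_) (toList-padRight m≤k a v)

Bool-↣ : Bool ↣ Fin 2
Bool-↣ = ↔⇒↣ (↔-sym 2↔Bool)

maybeToFin : ∀ {k} → Maybe (Fin k) → Fin (suc k)
maybeToFin nothing  = Fin.zero
maybeToFin (just i) = Fin.suc i

Maybe-↣ : ∀ {k} → Maybe (Fin k) ↣ Fin (suc k)
Maybe-↣ = mk↣ {to = maybeToFin} injective
  where
  injective : ∀ {x y} → maybeToFin x ≡ maybeToFin y → x ≡ y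
  injective {nothing} {nothing} _    = refl
  injective {just _}  {just _}  refl = refl

×-↣ : ∀ {A B : Set} {a b} → A ↣ Fin a → B ↣ Fin b → (A × B) ↣ Fin (a * b)
×-↣ {A} {B} {a} {b} f g = mk↣ {to = encode} injective
  where
  encode : A × B → Fin (a * b)
  encode (x , y) = combine (Injection.to f x) (Injection.to g y)
  injective : ∀ {u v} → encode u ≡ encode v → u ≡ v
  injective {x₁ , y₁} {x₂ , y₂} same with combine-injective _ _ _ _ same
  ... | same-x , same-y = cong₂ _,_ (Injection.injective f same-x) (Injection.injective g same-y)

Vec-↣ : ∀ {A : Set} {k m} → A ↣ Fin k → Vec A m ↣ Fin (k ^ m)
Vec-↣ {A} {k} {m} f = mk↣ {to = encode} injective
  where
  encode : Vec A m → Fin (k ^ m)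
  encode v = funToFin (Injection.to f ∘ lookup v)
  injective : ∀ {u v} → encode u ≡ encode v → u ≡ v
  injective {u} {v} same = begin
    u                    ≡⟨ tabulate∘lookup u ⟨
    tabulate (lookup u)  ≡⟨ tabulate-cong (λ t → Injection.injective f (begin
      Injection.to f (lookup u t)   ≡⟨ finToFun-funToFin (Injection.to f ∘ lookup u) t ⟨
      finToFun (encode u) t         ≡⟨ cong (λ c → finToFun c t) same ⟩
      finToFun (encode v) t         ≡⟨ finToFun-funToFin (Injection.to f ∘ lookup v) t ⟩
      Injection.to f (lookup v t)   ∎)) ⟩
    tabulate (lookup v)  ≡⟨ tabulate∘lookup v ⟩
    v                    ∎
    where open ≡-Reasoning

^-distribʳ-* : ∀ m n k → (m * n) ^ k ≡ m ^ k * n ^ k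
^-distribʳ-* m n zero    = refl
^-distribʳ-* m n (suc k) = trans (cong (m * n *_) (^-distribʳ-* m n k)) (interchange m n (m ^ k) (n ^ k))
  where
  interchange : ∀ a b c d → a * b * (c * d) ≡ a * c * (b * d)
  interchange = solve-∀

^-double : ∀ m q → m ^ (2 * q) ≡ m ^ q * m ^ q
^-double m q = trans (cong (m ^_) (two-times q)) (^-distribˡ-+-* m q q)
  where
  two-times : ∀ q → 2 * q ≡ q + q
  two-times = solve-∀

^-cancelˡ-≤ : ∀ k .{{_ : NonZero k}} {m n} → m ^ k ≤ n ^ k → m ≤ n
^-cancelˡ-≤ k mᵏ≤nᵏ = ≮⇒≥ (λ n<m → <⇒≱ (^-monoˡ-< k n<m) mᵏ≤nᵏ)

m≤m^n : ∀ m n .{{_ : NonZero n}} → m ≤ m ^ n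
m≤m^n zero    n       = z≤n
m≤m^n (suc m) (suc n) = m≤m*n (suc m) (suc m ^ n) {{m^n≢0 (suc m) n}}

n<2^n : ∀ n → n < 2 ^ n
n<2^n zero    = s≤s z≤n
n<2^n (suc n) = +-mono-≤ (m^n>0 2 n) (≤-trans (n<2^n n) (m≤m+n (2 ^ n) 0))

greatest : ∀ {P : ℕ → Set} → Decidable P → ∀ U → (∀ d → P d → d ≤ U) → ∀ m → P m →
  Σ ℕ λ M → P M × (∀ d → P d → d ≤ M)
greatest P? zero    bounded m pm with bounded m pm
... | z≤n = 0 , pm , bounded
greatest P? (suc U) bounded m pm with P? (suc U)
... | yes pU  = suc U , pU , bounded
... | no  ¬pU = greatest P? U (λ d pd → ≤-pred (≤∧≢⇒< (bounded d pd) (λ { refl → ¬pU pd }))) m pm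

k^[n∸k]≤n! : ∀ k n → k ^ (n ∸ k) ≤ n !
k^[n∸k]≤n! k zero    rewrite 0∸n≡0 k = ≤-refl
k^[n∸k]≤n! k (suc n) with suc n ≤? k
... | yes n<k rewrite m≤n⇒m∸n≡0 n<k = 1≤n! (suc n)
... | no  n≮k = begin
  k ^ (suc n ∸ k)      ≡⟨ cong (k ^_) (+-∸-assoc 1 k≤n) ⟩
  k * k ^ (n ∸ k)      ≤⟨ *-mono-≤ (≤-trans k≤n (n≤1+n n)) (k^[n∸k]≤n! k n) ⟩
  suc n * n !          ∎
  where
  open ≤-Reasoning
  k≤n : k ≤ n
  k≤n = ≤-pred (≰⇒> n≮k)

n^n≤m^n*n!*n^k : ∀ {m n k} .{{_ : NonZero m}} .{{_ : NonZero n}} → n ≤ k * m → n ^ n ≤ m ^ n * n ! * n ^ k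
n^n≤m^n*n!*n^k {m} {n} {k} n≤km with ≤-total k n
... | inj₂ n≤k = begin
  n ^ n                  ≤⟨ ^-monoʳ-≤ n n≤k ⟩
  n ^ k                  ≡⟨ *-identityˡ (n ^ k) ⟨
  1 * n ^ k              ≤⟨ *-monoˡ-≤ (n ^ k) (*-mono-≤ (m^n>0 m n) (1≤n! n)) ⟩
  m ^ n * n ! * n ^ k    ∎
  where open ≤-Reasoning
... | inj₁ k≤n = begin
  n ^ n                               ≡⟨ cong (n ^_) (m∸n+n≡m k≤n) ⟨
  n ^ (n ∸ k + k)                     ≡⟨ ^-distribˡ-+-* n (n ∸ k) k ⟩
  n ^ (n ∸ k) * n ^ k                 ≤⟨ *-monoˡ-≤ (n ^ k) (^-monoˡ-≤ (n ∸ k) n≤km) ⟩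
  (k * m) ^ (n ∸ k) * n ^ k           ≡⟨ cong (_* n ^ k) (^-distribʳ-* k m (n ∸ k)) ⟩
  k ^ (n ∸ k) * m ^ (n ∸ k) * n ^ k   ≤⟨ *-monoˡ-≤ (n ^ k) (*-mono-≤ (k^[n∸k]≤n! k n) (^-monoʳ-≤ m (m∸n≤m n k))) ⟩
  n ! * m ^ n * n ^ k                 ≡⟨ cong (_* n ^ k) (*-comm (n !) (m ^ n)) ⟩
  m ^ n * n ! * n ^ k                 ∎
  where open ≤-Reasoning

-- The counting bound

comparison-budget : ∀ p q n .{{_ : NonZero q}} .{{_ : NonZero n}} →
  Σ ℕ λ K → 2 ^ (K * 8 * q) ≤ n ^ (p * n) × (∀ c → 2 ^ (c * 8 * q) ≤ n ^ (p * n) → c ≤ K)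
comparison-budget p q n = greatest (λ c → 2 ^ (c * 8 * q) ≤? n ^ (p * n)) (n ^ (p * n)) bounded 0 (m^n>0 n (p * n))
  where
  bounded : ∀ c → 2 ^ (c * 8 * q) ≤ n ^ (p * n) → c ≤ n ^ (p * n)
  bounded c fits = ≤-trans (<⇒≤ (n<2^n c)) (≤-trans (^-monoʳ-≤ 2 (≤-trans (m≤m*n c 8) (m≤m*n (c * 8) q))) fits)

-- D ≈ n^(1 − ε/2) separates the short steps of a tour from its jumps.
step-budget : ∀ p q n .{{_ : NonZero q}} .{{_ : NonZero n}} → p ≤ 2 * q →
  Σ ℕ λ D → 1 ≤ D × D ^ (2 * q) * n ^ p ≤ n ^ (2 * q) × (∀ d → d ^ (2 * q) * n ^ p ≤ n ^ (2 * q) → d ≤ D)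
step-budget p q n p≤2q =
  let D , fits , maximal = greatest (λ d → d ^ (2 * q) * n ^ p ≤? n ^ (2 * q)) (n ^ (2 * q)) bounded 1 one-fits
  in  D , maximal 1 one-fits , fits , maximal
  where
  bounded : ∀ d → d ^ (2 * q) * n ^ p ≤ n ^ (2 * q) → d ≤ n ^ (2 * q)
  bounded d fits = ≤-trans (m≤m^n d (2 * q) {{m*n≢0 2 q}}) (≤-trans (m≤m*n (d ^ (2 * q)) (n ^ p) {{m^n≢0 n p}}) fits)
  one-fits : 1 ^ (2 * q) * n ^ p ≤ n ^ (2 * q)
  one-fits = subst (_≤ n ^ (2 * q)) (sym (trans (cong (_* n ^ p) (^-zeroˡ (2 * q))) (*-identityˡ (n ^ p)))) (^-monoʳ-≤ n p≤2q)

jumps≤D : ∀ {p q n B D} → (∀ d → d ^ (2 * q) * n ^ p ≤ n ^ (2 * q) → d ≤ D) →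
  (B * suc D) ^ q * n ^ p ≤ n ^ q * n ^ q → B ≤ D
jumps≤D {p} {q} {n} {B} {D} maximal cost-bound with B ^ (2 * q) * n ^ p ≤? n ^ (2 * q)
... | yes fits      = maximal B fits
... | no  B-too-big = ⊥-elim (<-irrefl refl (begin-strict
  n ^ (2 * q) * n ^ (2 * q)                              <⟨ *-mono-< (≰⇒> B-too-big) (≰⇒> D+1-too-big) ⟩
  B ^ (2 * q) * n ^ p * (suc D ^ (2 * q) * n ^ p)        ≡⟨ square ⟩
  (B * suc D) ^ q * n ^ p * ((B * suc D) ^ q * n ^ p)    ≤⟨ *-mono-≤ cost-bound cost-bound ⟩
  n ^ q * n ^ q * (n ^ q * n ^ q)                        ≡⟨ cong₂ _*_ (^-double n q) (^-double n q) ⟨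
  n ^ (2 * q) * n ^ (2 * q)                              ∎))
  where
  open ≤-Reasoning
  D+1-too-big : ¬ (suc D ^ (2 * q) * n ^ p ≤ n ^ (2 * q))
  D+1-too-big fits = 1+n≰n (maximal (suc D) fits)
  square : B ^ (2 * q) * n ^ p * (suc D ^ (2 * q) * n ^ p) ≡ (B * suc D) ^ q * n ^ p * ((B * suc D) ^ q * n ^ p)
  square = begin-equality
    B ^ (2 * q) * n ^ p * (suc D ^ (2 * q) * n ^ p)
      ≡⟨ cong₂ (λ b d → b * n ^ p * (d * n ^ p)) (^-double B q) (^-double (suc D) q) ⟩
    B ^ q * B ^ q * n ^ p * (suc D ^ q * suc D ^ q * n ^ p)
      ≡⟨ pair-up (B ^ q) (suc D ^ q) (n ^ p) ⟩
    B ^ q * suc D ^ q * n ^ p * (B ^ q * suc D ^ q * n ^ p)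
      ≡⟨ cong (λ x → x * n ^ p * (x * n ^ p)) (^-distribʳ-* B (suc D) q) ⟨
    (B * suc D) ^ q * n ^ p * ((B * suc D) ^ q * n ^ p) ∎
    where
    pair-up : ∀ b d x → b * b * x * (d * d * x) ≡ b * d * x * (b * d * x)
    pair-up = solve-∀

too-good-approximation : ∀ {p q n' C} .{{_ : NonZero q}} → 2 * q ≤ p → 1 ≤ C →
  C ^ q * suc n' ^ p ≤ suc n' ^ q * n' ^ q → ⊥
too-good-approximation {p} {q} {n'} {C} 2q≤p 1≤C approx = <-irrefl refl (begin-strict
  n ^ p                  ≡⟨ *-identityˡ (n ^ p) ⟨
  1 * n ^ p              ≤⟨ *-monoˡ-≤ (n ^ p) (subst (_≤ C ^ q) (^-zeroˡ q) (^-monoˡ-≤ q 1≤C)) ⟩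
  C ^ q * n ^ p          ≤⟨ approx ⟩
  n ^ q * n' ^ q         <⟨ *-monoʳ-< (n ^ q) {{m^n≢0 n q}} (^-monoˡ-< q (n<1+n n')) ⟩
  n ^ q * n ^ q          ≡⟨ ^-double n q ⟨
  n ^ (2 * q)            ≤⟨ ^-monoʳ-≤ n 2q≤p ⟩
  n ^ p                  ∎)
  where
  open ≤-Reasoning
  n = suc n'

2+[D+D]≤4*D : ∀ {D} → 1 ≤ D → 2 + (D + D) ≤ 4 * D
2+[D+D]≤4*D {D} 1≤D = begin
  2 + (D + D)          ≤⟨ +-monoˡ-≤ (D + D) (+-mono-≤ 1≤D 1≤D) ⟩
  D + D + (D + D)      ≡⟨ four-times D ⟩
  4 * D                ∎
  where
  open ≤-Reasoning
  four-times : ∀ D → D + D + (D + D) ≡ 4 * D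
  four-times = solve-∀

step-codes-bound : ∀ {p q n D} → 1 ≤ D → D ^ (2 * q) * n ^ p ≤ n ^ (2 * q) →
  ((2 + (D + D)) ^ n) ^ (16 * q) * n ^ (p * (8 * n)) ≤ 4 ^ (n * (16 * q)) * n ^ (n * (16 * q))
step-codes-bound {p} {q} {n} {D} 1≤D D-small = begin
  (c ^ n) ^ j * n ^ (p * (8 * n))                               ≡⟨ cong (_* n ^ (p * (8 * n))) (^-*-assoc c n j) ⟩
  c ^ (n * j) * n ^ (p * (8 * n))                               ≤⟨ *-monoˡ-≤ _ (^-monoˡ-≤ (n * j) (2+[D+D]≤4*D 1≤D)) ⟩
  (4 * D) ^ (n * j) * n ^ (p * (8 * n))                         ≡⟨ cong (_* n ^ (p * (8 * n))) (^-distribʳ-* 4 D (n * j)) ⟩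
  4 ^ (n * j) * D ^ (n * j) * n ^ (p * (8 * n))                 ≡⟨ *-assoc (4 ^ (n * j)) _ _ ⟩
  4 ^ (n * j) * (D ^ (n * j) * n ^ (p * (8 * n)))               ≡⟨ cong (4 ^ (n * j) *_) (cong₂ _*_ D-exponent (^-*-assoc n p (8 * n))) ⟨
  4 ^ (n * j) * ((D ^ (2 * q)) ^ (8 * n) * (n ^ p) ^ (8 * n))   ≡⟨ cong (4 ^ (n * j) *_) (^-distribʳ-* (D ^ (2 * q)) (n ^ p) (8 * n)) ⟨
  4 ^ (n * j) * (D ^ (2 * q) * n ^ p) ^ (8 * n)                 ≤⟨ *-monoʳ-≤ (4 ^ (n * j)) (^-monoˡ-≤ (8 * n) D-small) ⟩
  4 ^ (n * j) * (n ^ (2 * q)) ^ (8 * n)                         ≡⟨ cong (4 ^ (n * j) *_) n-exponent ⟩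
  4 ^ (n * j) * n ^ (n * j)                                     ∎
  where
  open ≤-Reasoning
  c : ℕ
  c = 2 + (D + D)
  j : ℕ
  j = 16 * q
  exponents : ∀ q n → 2 * q * (8 * n) ≡ n * (16 * q)
  exponents = solve-∀
  D-exponent : (D ^ (2 * q)) ^ (8 * n) ≡ D ^ (n * j)
  D-exponent = trans (^-*-assoc D (2 * q) (8 * n)) (cong (D ^_) (exponents q n))
  n-exponent : (n ^ (2 * q)) ^ (8 * n) ≡ n ^ (n * j)
  n-exponent = trans (^-*-assoc n (2 * q) (8 * n)) (cong (n ^_) (exponents q n))

factorial-upper-bound : ∀ {p q n K D} → 1 ≤ D → D ^ (2 * q) * n ^ p ≤ n ^ (2 * q) → 2 ^ (K * 8 * q) ≤ n ^ (p * n) →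
  n ! ≤ 2 ^ K * (n * ((2 + (D + D)) ^ n * n ^ D)) →
  (n !) ^ (16 * q) * n ^ (p * (8 * n)) ≤ 4 ^ (n * (16 * q)) * n ^ (p * n * 2 + 16 * q + D * (16 * q) + n * (16 * q))
factorial-upper-bound {p} {q} {n} {K} {D} 1≤D D-small few-comparisons count = begin
  (n !) ^ j * n ^ (p * (8 * n))
    ≤⟨ *-monoˡ-≤ _ (^-monoˡ-≤ j count) ⟩
  (2 ^ K * (n * (c ^ n * n ^ D))) ^ j * n ^ (p * (8 * n))
    ≡⟨ cong (_* n ^ (p * (8 * n))) powers-of-product ⟩
  (2 ^ K) ^ j * (n ^ j * ((c ^ n) ^ j * (n ^ D) ^ j)) * n ^ (p * (8 * n))
    ≡⟨ regroup ((2 ^ K) ^ j) (n ^ j) ((c ^ n) ^ j) ((n ^ D) ^ j) (n ^ (p * (8 * n))) ⟩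
  (2 ^ K) ^ j * n ^ j * (n ^ D) ^ j * ((c ^ n) ^ j * n ^ (p * (8 * n)))
    ≤⟨ *-mono-≤ (*-monoˡ-≤ ((n ^ D) ^ j) (*-monoˡ-≤ (n ^ j) comparisons-power)) (step-codes-bound {p} {q} {n} 1≤D D-small) ⟩
  n ^ (p * n * 2) * n ^ j * (n ^ D) ^ j * (4 ^ (n * j) * n ^ (n * j))
    ≡⟨ merge ⟩
  4 ^ (n * j) * n ^ (p * n * 2 + j + D * j + n * j) ∎
  where
  open ≤-Reasoning
  c : ℕ
  c = 2 + (D + D)
  j : ℕ
  j = 16 * q
  powers-of-product : (2 ^ K * (n * (c ^ n * n ^ D))) ^ j ≡ (2 ^ K) ^ j * (n ^ j * ((c ^ n) ^ j * (n ^ D) ^ j))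
  powers-of-product = trans (^-distribʳ-* (2 ^ K) _ j)
    (cong ((2 ^ K) ^ j *_) (trans (^-distribʳ-* n _ j) (cong (n ^ j *_) (^-distribʳ-* (c ^ n) (n ^ D) j))))
  regroup : ∀ a b c d e → a * (b * (c * d)) * e ≡ a * b * d * (c * e)
  regroup = solve-∀
  comparisons-power : (2 ^ K) ^ j ≤ n ^ (p * n * 2)
  comparisons-power = begin
    (2 ^ K) ^ j               ≡⟨ ^-*-assoc 2 K j ⟩
    2 ^ (K * j)               ≡⟨ cong (2 ^_) (double K q) ⟩
    2 ^ (K * 8 * q * 2)       ≡⟨ ^-*-assoc 2 (K * 8 * q) 2 ⟨
    (2 ^ (K * 8 * q)) ^ 2     ≤⟨ ^-monoˡ-≤ 2 few-comparisons ⟩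
    (n ^ (p * n)) ^ 2         ≡⟨ ^-*-assoc n (p * n) 2 ⟩
    n ^ (p * n * 2)           ∎
    where
    double : ∀ K q → K * (16 * q) ≡ K * 8 * q * 2
    double = solve-∀
  merge : n ^ (p * n * 2) * n ^ j * (n ^ D) ^ j * (4 ^ (n * j) * n ^ (n * j)) ≡ 4 ^ (n * j) * n ^ (p * n * 2 + j + D * j + n * j)
  merge = begin-equality
    n ^ (p * n * 2) * n ^ j * (n ^ D) ^ j * (4 ^ (n * j) * n ^ (n * j))
      ≡⟨ cong (λ x → n ^ (p * n * 2) * n ^ j * x * (4 ^ (n * j) * n ^ (n * j))) (^-*-assoc n D j) ⟩
    n ^ (p * n * 2) * n ^ j * n ^ (D * j) * (4 ^ (n * j) * n ^ (n * j))
      ≡⟨ rotate (n ^ (p * n * 2)) (n ^ j) (n ^ (D * j)) (4 ^ (n * j)) (n ^ (n * j)) ⟩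
    4 ^ (n * j) * (n ^ (p * n * 2) * n ^ j * n ^ (D * j) * n ^ (n * j))
      ≡⟨ cong (4 ^ (n * j) *_) (n^[a+b+c+d] (p * n * 2) j (D * j) (n * j)) ⟨
    4 ^ (n * j) * n ^ (p * n * 2 + j + D * j + n * j) ∎
    where
    rotate : ∀ a b c d e → a * b * c * (d * e) ≡ d * (a * b * c * e)
    rotate = solve-∀
    n^[a+b+c+d] : ∀ a b c d → n ^ (a + b + c + d) ≡ n ^ a * n ^ b * n ^ c * n ^ d
    n^[a+b+c+d] a b c d = trans (^-distribˡ-+-* n (a + b + c) d)
      (cong (_* n ^ d) (trans (^-distribˡ-+-* n (a + b) c) (cong (_* n ^ c) (^-distribˡ-+-* n a b))))

D*16q≤n : ∀ {p q n D} .{{_ : NonZero p}} .{{_ : NonZero q}} .{{_ : NonZero n}} →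
  (16 * q) ^ (2 * q) ≤ n → D ^ (2 * q) * n ^ p ≤ n ^ (2 * q) → D * (16 * q) ≤ n
D*16q≤n {p} {q} {n} {D} j^2q≤n D-small = ^-cancelˡ-≤ (2 * q) {{m*n≢0 2 q}} (*-cancelʳ-≤ _ _ (n ^ p) {{m^n≢0 n p}} (begin
  (D * j) ^ (2 * q) * n ^ p                ≡⟨ cong (_* n ^ p) (^-distribʳ-* D j (2 * q)) ⟩
  D ^ (2 * q) * j ^ (2 * q) * n ^ p        ≡⟨ swap (D ^ (2 * q)) (j ^ (2 * q)) (n ^ p) ⟩
  j ^ (2 * q) * (D ^ (2 * q) * n ^ p)      ≤⟨ *-mono-≤ j^2q≤n D-small ⟩
  n * n ^ (2 * q)                          ≤⟨ *-monoˡ-≤ (n ^ (2 * q)) (m≤m^n n p) ⟩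
  n ^ p * n ^ (2 * q)                      ≡⟨ *-comm (n ^ p) (n ^ (2 * q)) ⟩
  n ^ (2 * q) * n ^ p                      ∎))
  where
  open ≤-Reasoning
  j : ℕ
  j = 16 * q
  swap : ∀ a b c → a * b * c ≡ b * (a * c)
  swap = solve-∀

[16q]^[2q]≤n : ∀ {q n} .{{_ : NonZero q}} → (64 * q) ^ (16 * q) < n → (16 * q) ^ (2 * q) ≤ n
[16q]^[2q]≤n {q} {n} large = begin
  (16 * q) ^ (2 * q)   ≤⟨ ^-monoˡ-≤ (2 * q) (*-monoˡ-≤ q {16} {64} (m≤m+n 16 48)) ⟩
  (64 * q) ^ (2 * q)   ≤⟨ ^-monoʳ-≤ (64 * q) {{m*n≢0 64 q}} (*-monoˡ-≤ q {2} {16} (m≤m+n 2 14)) ⟩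
  (64 * q) ^ (16 * q)  ≤⟨ <⇒≤ large ⟩
  n                    ∎
  where open ≤-Reasoning

[4*16q]^[n*16q]<nⁿ : ∀ {q n} .{{_ : NonZero n}} → (64 * q) ^ (16 * q) < n → (4 * (16 * q)) ^ (n * (16 * q)) < n ^ n
[4*16q]^[n*16q]<nⁿ {q} {n} large = begin-strict
  (4 * j) ^ (n * j)    ≡⟨ cong ((4 * j) ^_) (*-comm n j) ⟩
  (4 * j) ^ (j * n)    ≡⟨ ^-*-assoc (4 * j) j n ⟨
  ((4 * j) ^ j) ^ n    ≡⟨ cong (λ b → (b ^ j) ^ n) (four-times-j q) ⟩
  ((64 * q) ^ j) ^ n   <⟨ ^-monoˡ-< n large ⟩
  n ^ n                ∎
  where
  open ≤-Reasoning
  j : ℕ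
  j = 16 * q
  four-times-j : ∀ q → 4 * (16 * q) ≡ 64 * q
  four-times-j = solve-∀

counting-inequality : ∀ {p q n K D k} .{{_ : NonZero q}} .{{_ : NonZero n}} →
  1 ≤ D → D ^ (2 * q) * n ^ p ≤ n ^ (2 * q) → 2 ^ (K * 8 * q) ≤ n ^ (p * n) →
  n ! ≤ 2 ^ K * (n * ((2 + (D + D)) ^ n * n ^ D)) → n ≤ k * (16 * q) →
  n ^ (n * (16 * q) + p * (8 * n)) ≤
    (4 * (16 * q)) ^ (n * (16 * q)) * n ^ (p * n * 2 + n * (16 * q) + (k * (16 * q) + 16 * q + D * (16 * q)))
counting-inequality {p} {q} {n} {K} {D} {k} 1≤D D-small few-comparisons count n≤k*j = begin
  n ^ (n * j + p * (8 * n))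
    ≡⟨ ^-distribˡ-+-* n (n * j) (p * (8 * n)) ⟩
  n ^ (n * j) * n ^ (p * (8 * n))
    ≡⟨ cong (_* n ^ (p * (8 * n))) (^-*-assoc n n j) ⟨
  (n ^ n) ^ j * n ^ (p * (8 * n))
    ≤⟨ *-monoˡ-≤ _ (^-monoˡ-≤ j (n^n≤m^n*n!*n^k {j} {n} {k} {{m*n≢0 16 q}} n≤k*j)) ⟩
  (j ^ n * n ! * n ^ k) ^ j * n ^ (p * (8 * n))
    ≡⟨ cong (_* n ^ (p * (8 * n))) powers-of-product ⟩
  (j ^ n) ^ j * (n !) ^ j * (n ^ k) ^ j * n ^ (p * (8 * n))
    ≡⟨ regroup ((j ^ n) ^ j) ((n !) ^ j) ((n ^ k) ^ j) (n ^ (p * (8 * n))) ⟩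
  (j ^ n) ^ j * (n ^ k) ^ j * ((n !) ^ j * n ^ (p * (8 * n)))
    ≤⟨ *-monoʳ-≤ ((j ^ n) ^ j * (n ^ k) ^ j) (factorial-upper-bound {p} {q} {n} {K} {D} 1≤D D-small few-comparisons count) ⟩
  (j ^ n) ^ j * (n ^ k) ^ j * (4 ^ (n * j) * n ^ X)
    ≡⟨ cong₂ (λ a b → a * b * (4 ^ (n * j) * n ^ X)) (^-*-assoc j n j) (^-*-assoc n k j) ⟩
  j ^ (n * j) * n ^ (k * j) * (4 ^ (n * j) * n ^ X)
    ≡⟨ interchange (j ^ (n * j)) (n ^ (k * j)) (4 ^ (n * j)) (n ^ X) ⟩
  4 ^ (n * j) * j ^ (n * j) * (n ^ (k * j) * n ^ X)
    ≡⟨ cong₂ _*_ (^-distribʳ-* 4 j (n * j)) (^-distribˡ-+-* n (k * j) X) ⟨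
  (4 * j) ^ (n * j) * n ^ (k * j + X)
    ≡⟨ cong (λ e → (4 * j) ^ (n * j) * n ^ e) (exponents p n j (k * j) (D * j)) ⟩
  (4 * j) ^ (n * j) * n ^ (p * n * 2 + n * j + (k * j + j + D * j)) ∎
  where
  open ≤-Reasoning
  j : ℕ
  j = 16 * q
  X : ℕ
  X = p * n * 2 + j + D * j + n * j
  powers-of-product : (j ^ n * n ! * n ^ k) ^ j ≡ (j ^ n) ^ j * (n !) ^ j * (n ^ k) ^ j
  powers-of-product = trans (^-distribʳ-* (j ^ n * n !) (n ^ k) j) (cong (_* (n ^ k) ^ j) (^-distribʳ-* (j ^ n) (n !) j))
  regroup : ∀ a b c d → a * b * c * d ≡ a * c * (b * d)
  regroup = solve-∀
  interchange : ∀ a b c d → a * b * (c * d) ≡ c * a * (b * d)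
  interchange = solve-∀
  exponents : ∀ p n j kj Dj → kj + (p * n * 2 + j + Dj + n * j) ≡ p * n * 2 + n * j + (kj + j + Dj)
  exponents = solve-∀

encoding-too-small : ∀ {p q n K D} .{{_ : NonZero p}} .{{_ : NonZero q}} → (64 * q) ^ (16 * q) < n →
  1 ≤ D → D ^ (2 * q) * n ^ p ≤ n ^ (2 * q) → 2 ^ (K * 8 * q) ≤ n ^ (p * n) →
  n ! ≤ 2 ^ K * (n * ((2 + (D + D)) ^ n * n ^ D)) → ⊥
encoding-too-small {p} {q} {n} {K} {D} large 1≤D D-small few-comparisons count = <-irrefl refl (begin-strict
  n ^ (n * j + p * (8 * n))
    ≤⟨ counting-inequality {p} {q} {n} {K} {D} {k} 1≤D D-small few-comparisons count n≤k*j ⟩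
  (4 * j) ^ (n * j) * n ^ (p * n * 2 + n * j + (k * j + j + D * j))
    ≤⟨ *-monoʳ-≤ ((4 * j) ^ (n * j)) (^-monoʳ-≤ n (+-monoʳ-≤ (p * n * 2 + n * j) budget)) ⟩
  (4 * j) ^ (n * j) * n ^ (p * n * 2 + n * j + 4 * n)
    <⟨ *-monoˡ-< (n ^ (p * n * 2 + n * j + 4 * n)) {{m^n≢0 n (p * n * 2 + n * j + 4 * n)}} ([4*16q]^[n*16q]<nⁿ {q} large) ⟩
  n ^ n * n ^ (p * n * 2 + n * j + 4 * n)
    ≡⟨ ^-distribˡ-+-* n n _ ⟨
  n ^ (n + (p * n * 2 + n * j + 4 * n))
    ≤⟨ ^-monoʳ-≤ n exponents-≤ ⟩
  n ^ (n * j + p * (8 * n)) ∎)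
  where
  open ≤-Reasoning
  j : ℕ
  j = 16 * q
  instance
    n≢0 : NonZero n
    n≢0 = >-nonZero (<-trans (m^n>0 (64 * q) {{m*n≢0 64 q}} (16 * q)) large)
    j≢0 : NonZero j
    j≢0 = m*n≢0 16 q
  -- k = ⌊n/16q⌋ + 1 satisfies n ≤ 16q·k ≤ n + 16q, so the factorial bound n^n ≤ (16q)^n · n! · n^k loses only n^k.
  k : ℕ
  k = suc (n / j)
  n≤k*j : n ≤ k * j
  n≤k*j = begin
    n                   ≡⟨ m≡m%n+[m/n]*n n j ⟩
    n % j + n / j * j   ≤⟨ +-monoˡ-≤ (n / j * j) (m%n≤n n j) ⟩
    k * j               ∎
  budget : k * j + j + D * j ≤ 4 * n
  budget = begin
    k * j + j + D * j   ≤⟨ +-mono-≤ (+-mono-≤ (+-mono-≤ j≤n (m/n*n≤m n j)) j≤n) (D*16q≤n {p} {q} {n} {D} j^[2q]≤n D-small) ⟩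
    n + n + n + n       ≡⟨ four-times n ⟩
    4 * n               ∎
    where
    j^[2q]≤n : (16 * q) ^ (2 * q) ≤ n
    j^[2q]≤n = [16q]^[2q]≤n {q} large
    j≤n : j ≤ n
    j≤n = ≤-trans (m≤m^n j (2 * q) {{m*n≢0 2 q}}) j^[2q]≤n
    four-times : ∀ n → n + n + n + n ≡ 4 * n
    four-times = solve-∀
  exponents-≤ : n + (p * n * 2 + n * j + 4 * n) ≤ n * j + p * (8 * n)
  exponents-≤ = begin
    n + (p * n * 2 + n * j + 4 * n)        ≡⟨ left-form n p j ⟩
    n * j + (p * n * 2 + 5 * n)            ≤⟨ +-monoʳ-≤ (n * j) (+-monoʳ-≤ (p * n * 2) (*-mono-≤ (n≤1+n 5) (m≤n*m n p))) ⟩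
    n * j + (p * n * 2 + 6 * (p * n))      ≡⟨ right-form n p j ⟩
    n * j + p * (8 * n)                    ∎
    where
    left-form : ∀ n p j → n + (p * n * 2 + n * j + 4 * n) ≡ n * j + (p * n * 2 + 5 * n)
    left-form = solve-∀
    right-form : ∀ n p j → n * j + (p * n * 2 + 6 * (p * n)) ≡ n * j + p * (8 * n)
    right-form = solve-∀

-- Hard inputs

module HardInputs {n'} (T : Tree (suc n')) where

  n : ℕ
  n = suc n'

  hardInput : Fin (n !) → Input n
  hardInput i = tabulate (ι ∘ toℕ ∘ (permutation n i ⟨$⟩ʳ_))

  route : Fin (n !) → Fin n → Fin n
  route i u = permutation n i ⟨$⟩ʳ (run T (hardInput i) ⟨$⟩ʳ u)

  routeCost : Fin (n !) → ℕ
  routeCost i = pathCostℕ (toList (Vec.map toℕ (tabulate (route i))))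

  routeCost-positive : 2 ≤ n → ∀ i → 1 ≤ routeCost i
  routeCost-positive 2≤n i = injective-pathCost (route i) 2≤n
    (Injection.injective (↔⇒↣ (run T (hardInput i))) ∘ Injection.injective (↔⇒↣ (permutation n i)))

  tourCost-run : ∀ i → tourCost (hardInput i) (run T (hardInput i)) ≡ ι (routeCost i)
  tourCost-run i = trans (tourCost-tabulate-ι (toℕ ∘ (permutation n i ⟨$⟩ʳ_)) (run T (hardInput i)))
                         (cong (ι ∘ pathCostℕ ∘ toList) (tabulate-∘ toℕ (route i)))

  approximation : ∀ {p q} → IsApprox n p q T → ∀ i → routeCost i ^ q * n ^ p ≤ n ^ q * n' ^ q
  approximation {p} {q} approx i = ι-cancel-≤ (subst₂ ℚ._≤_ found optimal (approx (hardInput i) (flip (permutation n i))))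
    where
    found : tourCost (hardInput i) (run T (hardInput i)) ^ℚ q ℚ.* ℕ→ℚ n ^ℚ p ≡ ι (routeCost i ^ q * n ^ p)
    found = trans (cong₂ (λ a b → a ^ℚ q ℚ.* b ^ℚ p) (tourCost-run i) (ℕ→ℚ≡ι n)) (ι-monomial (routeCost i) n q p)
    optimal : ℕ→ℚ n ^ℚ q ℚ.* tourCost (hardInput i) (flip (permutation n i)) ^ℚ q ≡ ι (n ^ q * n' ^ q)
    optimal = trans (cong₂ (λ a b → a ^ℚ q ℚ.* b ^ℚ q) (ℕ→ℚ≡ι n) (tourCost-sorting (permutation n i)))
                    (ι-monomial n n' q q)

  routeHead : Fin (n !) → Fin n
  routeHead i = route i Fin.zero

  routeTail : Fin (n !) → Vec (Fin n) n'
  routeTail i = tabulate (route i ∘ Fin.suc)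

  module Encoding (K D : ℕ) (few-comparisons : ∀ i → comparisons T (hardInput i) ≤ K)
                  (few-jumps : ∀ i → List.length (DifferenceCoding.jumps D (toℕ (routeHead i)) (routeTail i)) ≤ D) where

    open DifferenceCoding D

    Code : Set
    Code = Vec Bool K × Fin n × Vec Step n' × Vec (Fin n) D

    encode : Fin (n !) → Code
    encode i = transcript T (hardInput i) K , routeHead i , steps (toℕ (routeHead i)) (routeTail i) ,
               padRight (few-jumps i) Fin.zero (fromList (jumps (toℕ (routeHead i)) (routeTail i)))

    positions : Code → Fin n → ℕ
    positions (bits , a , ss , js) t = lookup (toℕ a ∷ follow (toℕ a) ss (toList js)) (replay T bits ⟨$⟩ˡ t)

    positions-encode : ∀ i t → positions (encode i) t ≡ toℕ (permutation n i ⟨$⟩ʳ t)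
    positions-encode i t = begin
      lookup (toℕ (routeHead i) ∷ follow (toℕ (routeHead i)) (steps (toℕ (routeHead i)) (routeTail i)) (toList js)) (replay T bits ⟨$⟩ˡ t)
        ≡⟨ cong₂ (λ ys σ → lookup (toℕ (routeHead i) ∷ ys) (σ ⟨$⟩ˡ t)) walk (replay-transcript T (hardInput i) (few-comparisons i)) ⟩
      lookup (Vec.map toℕ (tabulate (route i))) (σ ⟨$⟩ˡ t)
        ≡⟨ lookup-map (σ ⟨$⟩ˡ t) toℕ (tabulate (route i)) ⟩
      toℕ (lookup (tabulate (route i)) (σ ⟨$⟩ˡ t))
        ≡⟨ cong toℕ (lookup∘tabulate (route i) (σ ⟨$⟩ˡ t)) ⟩
      toℕ (permutation n i ⟨$⟩ʳ (σ ⟨$⟩ʳ (σ ⟨$⟩ˡ t)))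
        ≡⟨ cong (λ u → toℕ (permutation n i ⟨$⟩ʳ u)) (inverseʳ σ) ⟩
      toℕ (permutation n i ⟨$⟩ʳ t) ∎
      where
      open ≡-Reasoning
      σ : Permutation′ n
      σ = run T (hardInput i)
      bits : Vec Bool K
      bits = transcript T (hardInput i) K
      js : Vec (Fin n) D
      js = padRight (few-jumps i) Fin.zero (fromList (jumps (toℕ (routeHead i)) (routeTail i)))
      walk : follow (toℕ (routeHead i)) (steps (toℕ (routeHead i)) (routeTail i)) (toList js) ≡ Vec.map toℕ (routeTail i)
      walk = trans (cong (follow (toℕ (routeHead i)) (steps (toℕ (routeHead i)) (routeTail i)))
                         (trans (toList-padRight (few-jumps i) Fin.zero _) (cong (_++ padding) (toList∘fromList jumped))))
                   (follow-steps (toℕ (routeHead i)) (routeTail i) padding)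
        where
        jumped : List (Fin n)
        jumped = jumps (toℕ (routeHead i)) (routeTail i)
        padding : List (Fin n)
        padding = List.replicate (D ∸ List.length jumped) Fin.zero

    encode-injective : Injective _≡_ _≡_ encode
    encode-injective {i} {j} same = permutation-injective n λ t →
      toℕ-injective (trans (sym (positions-encode i t)) (trans (cong (λ c → positions c t) same) (positions-encode j t)))

    Code-↣ : Code ↣ Fin (2 ^ K * (n * (suc (suc (D + D)) ^ n' * n ^ D)))
    Code-↣ = ×-↣ (Vec-↣ Bool-↣) (×-↣ (↣-id _) (×-↣ (Vec-↣ Maybe-↣) (Vec-↣ (↣-id _))))

    count : n ! ≤ 2 ^ K * (n * (suc (suc (D + D)) ^ n' * n ^ D))
    count = injective⇒≤ (encode-injective ∘ Injection.injective Code-↣)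

  few-comparisons-impossible : ∀ {p q} .{{_ : NonZero p}} .{{_ : NonZero q}} → (64 * q) ^ (16 * q) < n → p < 2 * q →
    IsApprox n p q T → (∀ i → 2 ^ (comparisons T (hardInput i) * 8 * q) < n ^ (p * n)) → ⊥
  few-comparisons-impossible {p} {q} large p<2q approx cheap with comparison-budget p q n | step-budget p q n (<⇒≤ p<2q)
  ... | K , K-fits , K-maximal | D , 1≤D , D-small , D-maximal =
    encoding-too-small {p} {q} {n} {K} {D} large 1≤D D-small K-fits
      (≤-trans (Encoding.count K D few-comparisons few-jumps) steps-of-length-n)
    where
    few-comparisons : ∀ i → comparisons T (hardInput i) ≤ K
    few-comparisons i = K-maximal _ (<⇒≤ (cheap i))
    few-jumps : ∀ i → List.length (DifferenceCoding.jumps D (toℕ (routeHead i)) (routeTail i)) ≤ D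
    few-jumps i = jumps≤D {p} {q} {n} D-maximal (begin
      (B * suc D) ^ q * n ^ p   ≤⟨ *-monoˡ-≤ (n ^ p) (^-monoˡ-≤ q (DifferenceCoding.jumps-cost D (toℕ (routeHead i)) (routeTail i))) ⟩
      routeCost i ^ q * n ^ p   ≤⟨ approximation {p} {q} approx i ⟩
      n ^ q * n' ^ q            ≤⟨ *-monoʳ-≤ (n ^ q) (^-monoˡ-≤ q (n≤1+n n')) ⟩
      n ^ q * n ^ q             ∎)
      where
      open ≤-Reasoning
      B : ℕ
      B = List.length (DifferenceCoding.jumps D (toℕ (routeHead i)) (routeTail i))
    steps-of-length-n : 2 ^ K * (n * (suc (suc (D + D)) ^ n' * n ^ D)) ≤ 2 ^ K * (n * (suc (suc (D + D)) ^ n * n ^ D))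
    steps-of-length-n = *-monoʳ-≤ (2 ^ K) (*-monoʳ-≤ n (*-monoˡ-≤ (n ^ D) (^-monoʳ-≤ (suc (suc (D + D))) (n≤1+n n'))))

  lower-bound : ∀ {p q} .{{_ : NonZero p}} .{{_ : NonZero q}} → (64 * q) ^ (16 * q) < n → IsApprox n p q T →
    ∃ λ xs → n ^ (p * n) ≤ 2 ^ (comparisons T xs * 8 * q)
  lower-bound {p} {q} large approx with 2 * q ≤? p
  ... | yes 2q≤p = ⊥-elim (too-good-approximation 2q≤p (routeCost-positive 2≤n some-i) (approximation {p} {q} approx some-i))
    where
    some-i : Fin (n !)
    some-i = fromℕ< (1≤n! n)
    2≤n : 2 ≤ n
    2≤n = <-≤-trans (s≤s (m^n>0 (64 * q) {{m*n≢0 64 q}} (16 * q))) large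
  ... | no  p≮2q with any? (λ i → n ^ (p * n) ≤? 2 ^ (comparisons T (hardInput i) * 8 * q))
  ...   | yes (i , expensive) = hardInput i , expensive
  ...   | no  all-cheap = ⊥-elim (few-comparisons-impossible large (≰⇒> p≮2q) approx (λ i → ≰⇒> (all-cheap ∘ (i ,_))))

theorem1 : Σ ℕ λ a → Σ ℕ λ b → 0 < a × 0 < b ×
    (∀ (p q : ℕ) → 0 < p → 0 < q →
      ∃ λ N → ∀ (n : ℕ) → N ≤ n → ∀ (T : Tree n) → IsApprox n p q T →
        ∃ λ (xs : Input n) → n ^ (a * p * n) ≤ 2 ^ (comparisons T xs * b * q))
theorem1 = 1 , 8 , z<s , z<s , λ p q p>0 q>0 → suc ((64 * q) ^ (16 * q)) , λ where
  (suc n') large T approx → subst (λ a → ∃ λ xs → suc n' ^ (a * suc n') ≤ 2 ^ (comparisons T xs * 8 * q)) (sym (*-identityˡ p))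
    (HardInputs.lower-bound T {{>-nonZero p>0}} {{>-nonZero q>0}} large approx)
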